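{- Let $k\geq 17$ be an integer and let $G$ be a finite simple graph with $\Delta(G)\leq k$ that admits no list $2$-distance $(k+2)$-coloring, but such that every proper subgraph of $G$ admits a list $2$-distance $(k+2)$-coloring. Then every positive vertex of $G$ has degree $k$, and every support vertex of $G$ is adjacent to exactly one positive vertex.
   Context: All graphs are finite and simple; $d(u)$ is the degree of $u$. A list $2$-distance $(k+2)$-coloring: for every assignment of lists of $k+2$ colors to the vertices, one can choose a color from each list so that vertices that are adjacent or have a common neighbor get distinct colors. A $1$-link between $x$ and $y$ is a path $x-a-y$ with $d(a)=2$. A vertex is weak if it has degree $3$ and two of its neighbors are degree-$2$ vertices whose other neighbors have degree at most $14$ (i.e. it is $1$-linked to two vertices of degree at most $14$, or twice $1$-linked to one such vertex). A vertex $x$ is a support vertex if: ($S_1$) $d(x)=2$ and $x$ is adjacent to another vertex of degree $2$; or ($S_2$) $d(x)=2$ and $x$ is adjacent to a vertex of degree $3$ which is adjacent to a vertex of degree $2$ (other than $x$) and to a vertex of degree at most $7$; or ($S_3$) $x$ is a weak vertex $1$-linked to another weak vertex. A vertex is positive if it has degree at least $4$ and is adjacent to a support vertex. -}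

module Defs where

open import Data.Nat using (ℕ; zero; suc; _+_; _≤_)
open import Data.Bool using (Bool; true; false; if_then_else_)
open import Data.Fin using (Fin)
open import Data.List using (List; length; map; allFin)
open import Data.Nat.ListAction using (sum)
open import Data.Empty using (⊥)
open import Data.List.Membership.Propositional using (_∈_)
open import Data.List.Relation.Unary.Unique.Propositional using (Unique)
open import Data.Product using (Σ; _×_; _,_; ∃; ∃-syntax)
open import Data.Sum using (_⊎_)
open import Relation.Binary.PropositionalEquality using (_≡_; _≢_)

record Graph : Set where
  field
    n      : ℕ
    adj    : Fin n → Fin n → Bool
    sym    : ∀ u v → adj u v ≡ true → adj v u ≡ true
    irrefl : ∀ v → adj v v ≡ false

open Graph public

Adj : (G : Graph) → Fin (n G) → Fin (n G) → Set
Adj G u v = adj G u v ≡ true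

deg : (G : Graph) → Fin (n G) → ℕ
deg G v = sum (map (λ w → if adj G v w then 1 else 0) (allFin (n G)))

MaxDegLe : Graph → ℕ → Set
MaxDegLe G k = ∀ v → deg G v ≤ k

record Subgraph (G : Graph) : Set where
  field
    V      : Fin (n G) → Bool
    E      : Fin (n G) → Fin (n G) → Bool
    E⊆adj  : ∀ u v → E u v ≡ true → adj G u v ≡ true
    E-sym  : ∀ u v → E u v ≡ true → E v u ≡ true
    E-ends : ∀ u v → E u v ≡ true → (V u ≡ true × V v ≡ true)

open Subgraph public

whole : (G : Graph) → Subgraph G
whole G = record
  { V = λ _ → true ; E = adj G
  ; E⊆adj = λ _ _ p → p ; E-sym = sym G
  ; E-ends = λ _ _ _ → _≡_.refl , _≡_.refl }

Proper : {G : Graph} → Subgraph G → Set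
Proper {G} H = (∃[ v ] V H v ≡ false) ⊎ (∃[ u ] ∃[ v ] (adj G u v ≡ true × E H u v ≢ true))

List2DistColorable : {G : Graph} → Subgraph G → ℕ → Set
List2DistColorable {G} H m =
  (L : Fin (n G) → List ℕ) →
  (∀ v → V H v ≡ true → (length (L v) ≡ m × Unique (L v))) →
  Σ (Fin (n G) → ℕ) λ c →
    (∀ v → V H v ≡ true → c v ∈ L v) ×
    (∀ u v → V H u ≡ true → V H v ≡ true → u ≢ v →
       (E H u v ≡ true ⊎ (∃[ w ] (E H u w ≡ true × E H w v ≡ true))) →
       c u ≢ c v)

Weak : (G : Graph) → Fin (n G) → Set
Weak G x =
  deg G x ≡ 3 ×
  ∃[ a₁ ] ∃[ a₂ ] ∃[ y₁ ] ∃[ y₂ ]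
    (a₁ ≢ a₂ × Adj G x a₁ × Adj G x a₂ × deg G a₁ ≡ 2 × deg G a₂ ≡ 2 ×
     Adj G a₁ y₁ × y₁ ≢ x × Adj G a₂ y₂ × y₂ ≢ x × deg G y₁ ≤ 14 × deg G y₂ ≤ 14)

OneLinked : (G : Graph) → Fin (n G) → Fin (n G) → Set
OneLinked G x y = x ≢ y × ∃[ a ] (Adj G x a × Adj G a y × deg G a ≡ 2)

Support : (G : Graph) → Fin (n G) → Set
Support G x =
  (deg G x ≡ 2 × ∃[ y ] (Adj G x y × deg G y ≡ 2))
  ⊎
  (deg G x ≡ 2 × ∃[ y ] ∃[ z ] ∃[ w ]
     (Adj G x y × deg G y ≡ 3 × Adj G y z × z ≢ x × deg G z ≡ 2 ×
      Adj G y w × w ≢ x × w ≢ z × deg G w ≤ 7))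
  ⊎
  (Weak G x × ∃[ y ] (OneLinked G x y × Weak G y))

Positive : (G : Graph) → Fin (n G) → Set
Positive G x = 4 ≤ deg G x × ∃[ s ] (Adj G x s × Support G s)

-- Each support vertex s has degree at most 3, and all its neighbours but one, p, have degree
-- at most 3; the point is that d(p) = k. Otherwise uncolour s together with its light
-- neighbours (S₁: the other degree-2 vertex, S₂: the degree-3 one, S₃: both pendant paths),
-- deleting from G all of them except, in S₂, the degree-3 vertex. By minimality the rest has a
-- list colouring, still 2-distance-proper away from the uncoloured set because each deleted
-- vertex has only one neighbour outside it. The uncoloured vertices are then coloured greedily:
-- each sees at most k + 1 coloured vertices within distance 2, using d(p) ≤ k - 1 next to p and
-- the small degrees (≤ 7, ≤ 14, with k ≥ 17) elsewhere. This colours G, a contradiction.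
module Submission where

open import Defs hiding (sym)
open import Data.Nat using (ℕ; suc; _≟_; _+_; _≤_; _<_; z≤n; s≤s)
open import Data.Nat.Properties
  using ( ≤-refl; ≤-trans; ≤-antisym; ≤-pred; ≤-reflexive; n≤1+n; suc-injective; <⇒≱; ≮⇒≥
        ; +-comm; +-monoˡ-≤; +-monoʳ-≤; m≤m+n)
open import Data.Bool using (Bool; true; false; not; _∧_; if_then_else_)
import Data.Bool as Bool
open import Data.Fin using (Fin)
import Data.Fin as Fin
open import Data.List using (List; []; _∷_; length; map; filter; allFin; _++_)
open import Data.List.Properties
  using (filter-all; filter-accept; filter-reject; filter-notAll; length-map; length-++)
open import Data.Nat.ListAction using (sum)
open import Data.List.Membership.Propositional using (_∈_; _∉_)
open import Data.List.Membership.Propositional.Properties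
  using (∈-filter⁺; ∈-filter⁻; ∈-allFin; ∈-map⁺; ∈-++⁺ˡ; ∈-++⁺ʳ)
open import Data.List.Relation.Binary.Subset.Propositional using (_⊆_)
open import Data.List.Relation.Unary.All as All using (All; []; _∷_)
open import Data.List.Relation.Unary.AllPairs using ([]; _∷_)
open import Data.List.Relation.Unary.Any as Any using (here; there)
open import Data.List.Relation.Unary.Unique.Propositional using (Unique)
open import Data.List.Relation.Unary.Unique.Propositional.Properties using (allFin⁺; filter⁺)
open import Data.Vec.Functional using (updateAt)
open import Data.Vec.Functional.Properties using (updateAt-updates; updateAt-minimal)
open import Data.Empty using (⊥; ⊥-elim)
open import Data.Unit using (⊤; tt)
open import Data.Product using (Σ; _×_; _,_; ∃-syntax; proj₁; proj₂)
open import Data.Sum using (_⊎_; inj₁; inj₂; map₁)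
open import Function using (id; _∘_; const)
open import Relation.Nullary using (¬_; yes; no; ¬?; does)
open import Relation.Binary.Definitions using (DecidableEquality)
open import Relation.Binary.PropositionalEquality using (_≡_; _≢_; refl; sym; trans; cong; subst; ≢-sym)

module _ {A : Set} where

  sum-indicator≡length-filter : (f : A → Bool) (xs : List A) →
    sum (map (λ x → if f x then 1 else 0) xs) ≡ length (filter (λ x → f x Bool.≟ true) xs)
  sum-indicator≡length-filter f [] = refl
  sum-indicator≡length-filter f (x ∷ xs) with f x
  ... | true  = cong suc (sum-indicator≡length-filter f xs)
  ... | false = sum-indicator≡length-filter f xs

  two-elements : ∀ {a xs} → Unique xs → length xs ≡ 2 → a ∈ xs →
    Σ A λ b → (b ≢ a × b ∈ xs × (∀ {u} → u ∈ xs → u ≡ a ⊎ u ≡ b))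
  two-elements {xs = x ∷ y ∷ []} ((x≢y ∷ []) ∷ _) refl (here refl) =
    y , ≢-sym x≢y , there (here refl) , λ { (here refl) → inj₁ refl ; (there (here refl)) → inj₂ refl }
  two-elements {xs = x ∷ y ∷ []} ((x≢y ∷ []) ∷ _) refl (there (here refl)) =
    x , x≢y , here refl , λ { (here refl) → inj₂ refl ; (there (here refl)) → inj₁ refl }

module Removal {A : Set} (_≟_ : DecidableEquality A) where

  infixl 6 _∖_
  _∖_ : List A → A → List A
  xs ∖ a = filter (λ u → ¬? (u ≟ a)) xs

  ∈-∖⁺ : ∀ {a u xs} → u ∈ xs → u ≢ a → u ∈ xs ∖ a
  ∈-∖⁺ {a} = ∈-filter⁺ (λ u → ¬? (u ≟ a))

  ∈-∖⁻ : ∀ {a u} xs → u ∈ xs ∖ a → u ∈ xs × u ≢ a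
  ∈-∖⁻ {a} xs = ∈-filter⁻ (λ u → ¬? (u ≟ a)) {xs = xs}

  ∖-unique : ∀ {a xs} → Unique xs → Unique (xs ∖ a)
  ∖-unique {a} = filter⁺ (λ u → ¬? (u ≟ a))

  length-∖-< : ∀ {a xs} → a ∈ xs → length (xs ∖ a) < length xs
  length-∖-< {a} {xs} a∈xs = filter-notAll (λ u → ¬? (u ≟ a)) xs (Any.map (λ { refl a≢a → a≢a refl }) a∈xs)

  length-∖-≥ : ∀ {a xs} → Unique xs → length xs ≤ suc (length (xs ∖ a))
  length-∖-≥ {a} {[]} [] = z≤n
  length-∖-≥ {a} {x ∷ xs} (x∉xs ∷ u) with x ≟ a
  ... | yes refl rewrite filter-reject (λ u → ¬? (u ≟ x)) {x = x} {xs = xs} (λ x≢x → x≢x refl)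
                       | filter-all (λ u → ¬? (u ≟ x)) (All.map ≢-sym x∉xs) = ≤-refl
  ... | no x≢a rewrite filter-accept (λ u → ¬? (u ≟ a)) {x = x} {xs = xs} x≢a = s≤s (length-∖-≥ u)

  length-∖ : ∀ {a xs} → Unique xs → a ∈ xs → suc (length (xs ∖ a)) ≡ length xs
  length-∖ u a∈xs = ≤-antisym (length-∖-< a∈xs) (length-∖-≥ u)

  free-element : ∀ xs {ys} → Unique ys → length xs < length ys → ∃[ z ] (z ∈ ys × z ∉ xs)
  free-element [] {y ∷ _} _ _ = y , here refl , λ ()
  free-element (x ∷ xs) {ys} u lt
    with free-element xs (∖-unique u) (≤-pred (≤-trans lt (length-∖-≥ u)))
  ... | z , z∈ys∖x , z∉xs with ∈-∖⁻ ys z∈ys∖x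
  ... | z∈ys , z≢x = z , z∈ys , λ { (here z≡x) → z≢x z≡x ; (there z∈xs) → z∉xs z∈xs }

  three-elements : ∀ {a b xs} → Unique xs → length xs ≡ 3 → a ∈ xs → b ∈ xs → b ≢ a →
    Σ A λ c → (c ≢ a × c ≢ b × c ∈ xs × (∀ {u} → u ∈ xs → u ≡ a ⊎ u ≡ b ⊎ u ≡ c))
  three-elements {a} {b} {xs} u len a∈xs b∈xs b≢a
    with two-elements (∖-unique u) (suc-injective (trans (length-∖ u a∈xs) len)) (∈-∖⁺ b∈xs b≢a)
  ... | c , c≢b , c∈xs∖a , cover with ∈-∖⁻ xs c∈xs∖a
  ... | c∈xs , c≢a = c , c≢a , c≢b , c∈xs , cover′
    where
    cover′ : ∀ {v} → v ∈ xs → v ≡ a ⊎ v ≡ b ⊎ v ≡ c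
    cover′ {v} v∈xs with v ≟ a
    ... | yes v≡a = inj₁ v≡a
    ... | no v≢a  = inj₂ (cover (∈-∖⁺ v∈xs v≢a))

module GraphFacts (G : Graph) where

  Vertex : Set
  Vertex = Fin (n G)

  open Removal (Fin._≟_ {n G}) public using (_∖_; ∈-∖⁺; length-∖-<; three-elements)
  open import Data.List.Membership.DecPropositional (Fin._≟_ {n G}) using (_∈?_)

  Adj-sym : ∀ {u v} → Adj G u v → Adj G v u
  Adj-sym = Graph.sym G _ _

  nbrs : Vertex → List Vertex
  nbrs x = filter (λ w → adj G x w Bool.≟ true) (allFin (n G))

  length-nbrs : ∀ x → length (nbrs x) ≡ deg G x
  length-nbrs x = sym (sum-indicator≡length-filter (adj G x) (allFin (n G)))

  ∈-nbrs⁺ : ∀ {x w} → Adj G x w → w ∈ nbrs x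
  ∈-nbrs⁺ {x} {w} = ∈-filter⁺ (λ w → adj G x w Bool.≟ true) (∈-allFin w)

  ∈-nbrs⁻ : ∀ {x w} → w ∈ nbrs x → Adj G x w
  ∈-nbrs⁻ {x} = proj₂ ∘ ∈-filter⁻ (λ w → adj G x w Bool.≟ true) {xs = allFin (n G)}

  nbrs-unique : ∀ x → Unique (nbrs x)
  nbrs-unique x = filter⁺ (λ w → adj G x w Bool.≟ true) (allFin⁺ (n G))

  ∈-nbrs∖ : ∀ {x u w} → Adj G x u → u ≢ w → u ∈ nbrs x ∖ w
  ∈-nbrs∖ = ∈-∖⁺ ∘ ∈-nbrs⁺

  length-nbrs∖ : ∀ {x w} → Adj G x w → length (nbrs x ∖ w) < deg G x
  length-nbrs∖ {x} {w} x~w = subst (length (nbrs x ∖ w) <_) (length-nbrs x) (length-∖-< (∈-nbrs⁺ x~w))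

  other-nbr-of-deg2 : ∀ {x a} → deg G x ≡ 2 → Adj G x a →
    ∃[ b ] (b ≢ a × Adj G x b × (∀ u → Adj G x u → u ≡ a ⊎ u ≡ b))
  other-nbr-of-deg2 {x} d x~a
    with two-elements (nbrs-unique x) (trans (length-nbrs x) d) (∈-nbrs⁺ x~a)
  ... | b , b≢a , b∈ , cover = b , b≢a , ∈-nbrs⁻ b∈ , λ u x~u → cover (∈-nbrs⁺ x~u)

  nbrs-of-deg2 : ∀ {x a b} → deg G x ≡ 2 → Adj G x a → Adj G x b → b ≢ a →
    ∀ u → Adj G x u → u ≡ a ⊎ u ≡ b
  nbrs-of-deg2 d x~a x~b b≢a with other-nbr-of-deg2 d x~a
  ... | _ , _ , _ , cover with cover _ x~b
  ... | inj₁ b≡a = ⊥-elim (b≢a b≡a)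
  ... | inj₂ refl = cover

  third-nbr-of-deg3 : ∀ {x a b} → deg G x ≡ 3 → Adj G x a → Adj G x b → b ≢ a →
    ∃[ c ] (c ≢ a × c ≢ b × Adj G x c × (∀ u → Adj G x u → u ≡ a ⊎ u ≡ b ⊎ u ≡ c))
  third-nbr-of-deg3 {x} d x~a x~b b≢a
    with three-elements (nbrs-unique x) (trans (length-nbrs x) d) (∈-nbrs⁺ x~a) (∈-nbrs⁺ x~b) b≢a
  ... | c , c≢a , c≢b , c∈ , cover = c , c≢a , c≢b , ∈-nbrs⁻ c∈ , λ u x~u → cover (∈-nbrs⁺ x~u)

  nbrs-of-deg3 : ∀ {x a b c} → deg G x ≡ 3 → Adj G x a → Adj G x b → Adj G x c →
    b ≢ a → c ≢ a → c ≢ b → ∀ u → Adj G x u → u ≡ a ⊎ u ≡ b ⊎ u ≡ c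
  nbrs-of-deg3 d x~a x~b x~c b≢a c≢a c≢b with third-nbr-of-deg3 d x~a x~b b≢a
  ... | _ , _ , _ , _ , cover with cover _ x~c
  ... | inj₁ c≡a = ⊥-elim (c≢a c≡a)
  ... | inj₂ (inj₁ c≡b) = ⊥-elim (c≢b c≡b)
  ... | inj₂ (inj₂ refl) = cover

  Near : Vertex → Vertex → Set
  Near u v = Adj G u v ⊎ ∃[ w ] (Adj G u w × Adj G w v)

  Near-sym : ∀ {u v} → Near u v → Near v u
  Near-sym (inj₁ u~v) = inj₁ (Adj-sym u~v)
  Near-sym (inj₂ (w , u~w , w~v)) = inj₂ (w , Adj-sym w~v , Adj-sym u~w)

  -- When x is coloured while the vertices of rest are still uncoloured, only the colours of
  -- the blockers are forbidden at x.
  record Blockers (m : ℕ) (rest : List Vertex) (x : Vertex) : Set where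
    field
      blockers : List Vertex
      few      : length blockers < m
      covers   : ∀ u → u ∉ rest → u ≢ x → Near x u → u ∈ blockers

  data GreedyOrder (m : ℕ) : List Vertex → Set where
    []  : GreedyOrder m []
    _∷_ : ∀ {x rest} → Blockers m rest x → GreedyOrder m rest → GreedyOrder m (x ∷ rest)

  OneNbrOutside : List Vertex → Vertex → Set
  OneNbrOutside U w = ∃[ p ] (∀ u → Adj G w u → u ∈ U ⊎ u ≡ p)

  kept : List Vertex → Vertex → Bool
  kept R u = not (does (u ∈? R))

  kept-∈ : ∀ {R u} → u ∈ R → kept R u ≡ false
  kept-∈ {R} {u} u∈R with u ∈? R
  ... | yes _   = refl
  ... | no u∉R = ⊥-elim (u∉R u∈R)

  kept-∉ : ∀ {R u} → u ∉ R → kept R u ≡ true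
  kept-∉ {R} {u} u∉R with u ∈? R
  ... | yes u∈R = ⊥-elim (u∉R u∈R)
  ... | no _    = refl

  ∧-true : ∀ {a b} → a ∧ b ≡ true → a ≡ true × b ≡ true
  ∧-true {true} {true} _ = refl , refl

  true-∧ : ∀ {a b} → a ≡ true → b ≡ true → a ∧ b ≡ true
  true-∧ refl refl = refl

  delete : List Vertex → Subgraph G
  delete R = record
    { V      = kept R
    ; E      = λ u v → adj G u v ∧ (kept R u ∧ kept R v)
    ; E⊆adj  = λ u v → proj₁ ∘ ∧-true {adj G u v}
    ; E-sym  = λ u v e → let (u~v , kept-uv) = ∧-true {adj G u v} e
                             (ku , kv)       = ∧-true {kept R u} kept-uv
                         in true-∧ (Adj-sym u~v) (true-∧ kv ku)
    ; E-ends = λ u v e → ∧-true {kept R u} (proj₂ (∧-true {adj G u v} e))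
    }

  outside-nbrs-equal : ∀ {U w u v} → OneNbrOutside U w → Adj G w u → Adj G w v → u ∉ U → v ∉ U → u ≡ v
  outside-nbrs-equal (p , cover) w~u w~v u∉U v∉U with cover _ w~u | cover _ w~v
  ... | inj₁ u∈U | _         = ⊥-elim (u∉U u∈U)
  ... | _        | inj₁ v∈U  = ⊥-elim (v∉U v∈U)
  ... | inj₂ refl | inj₂ refl = refl

  module Colouring (L : Vertex → List ℕ) where

    open Removal _≟_ using (free-element)

    ProperOn : (Vertex → Set) → (Vertex → ℕ) → Set
    ProperOn C c = (∀ v → C v → c v ∈ L v) × (∀ u v → C u → C v → u ≢ v → Near u v → c u ≢ c v)

    ProperOn-mono : ∀ {C D c} → (∀ u → D u → C u) → ProperOn C c → ProperOn D c
    ProperOn-mono D⊆C (inL , distinct) =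
      (λ v → inL v ∘ D⊆C v) , λ u v du dv → distinct u v (D⊆C u du) (D⊆C v dv)

    extend : ∀ {C c x} S → ProperOn C c → Unique (L x) → length S < length (L x) →
      (∀ u → C u → u ≢ x → Near x u → u ∈ S) → ∃[ c′ ] ProperOn (λ u → C u ⊎ u ≡ x) c′
    extend {C} {c} {x} S (inL , distinct) uniq few covers
      with free-element (map c S) uniq (subst (_< length (L x)) (sym (length-map c S)) few)
    ... | col , col∈Lx , col∉cS = c′ , inL′ , distinct′
      where
      c′ : Vertex → ℕ
      c′ = updateAt c x (const col)

      c′-at-x : c′ x ≡ col
      c′-at-x = updateAt-updates x c

      c′-elsewhere : ∀ {u} → u ≢ x → c′ u ≡ c u
      c′-elsewhere {u} u≢x = updateAt-minimal u x c u≢x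

      col-free : ∀ u → C u → u ≢ x → Near x u → col ≢ c u
      col-free u cu u≢x x≈u col≡cu =
        col∉cS (subst (_∈ map c S) (sym col≡cu) (∈-map⁺ c (covers u cu u≢x x≈u)))

      old : ∀ {u} → C u ⊎ u ≡ x → u ≢ x → C u
      old (inj₁ cu)  _   = cu
      old (inj₂ u≡x) u≢x = ⊥-elim (u≢x u≡x)

      inL′ : ∀ v → C v ⊎ v ≡ x → c′ v ∈ L v
      inL′ v cv with v Fin.≟ x
      ... | yes refl = subst (_∈ L v) (sym c′-at-x) col∈Lx
      ... | no v≢x   = subst (_∈ L v) (sym (c′-elsewhere v≢x)) (inL v (old cv v≢x))

      distinct′ : ∀ u v → C u ⊎ u ≡ x → C v ⊎ v ≡ x → u ≢ v → Near u v → c′ u ≢ c′ v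
      distinct′ u v cu cv u≢v u≈v with u Fin.≟ x | v Fin.≟ x
      ... | yes refl | yes refl = ⊥-elim (u≢v refl)
      ... | yes refl | no v≢x   = λ eq →
        col-free v (old cv v≢x) v≢x u≈v (trans (sym c′-at-x) (trans eq (c′-elsewhere v≢x)))
      ... | no u≢x   | yes refl = λ eq →
        col-free u (old cu u≢x) u≢x (Near-sym u≈v) (trans (sym c′-at-x) (trans (sym eq) (c′-elsewhere u≢x)))
      ... | no u≢x   | no v≢x   = λ eq →
        distinct u v (old cu u≢x) (old cv v≢x) u≢v u≈v
          (trans (sym (c′-elsewhere u≢x)) (trans eq (c′-elsewhere v≢x)))

    greedy : ∀ {m U c} → (∀ v → length (L v) ≡ m × Unique (L v)) → GreedyOrder m U →
      ProperOn (_∉ U) c → ∃[ c′ ] ProperOn (λ _ → ⊤) c′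
    greedy _ [] proper = _ , ProperOn-mono (λ _ _ ()) proper
    greedy {U = x ∷ rest} lists (b ∷ order) proper =
      greedy lists order (ProperOn-mono coloured (proj₂ (extend blockers proper (proj₂ (lists x)) few′ covers′)))
      where
      open Blockers b

      few′ : length blockers < length (L x)
      few′ = subst (length blockers <_) (sym (proj₁ (lists x))) few

      covers′ : ∀ u → u ∉ x ∷ rest → u ≢ x → Near x u → u ∈ blockers
      covers′ u u∉ = covers u (u∉ ∘ there)

      coloured : ∀ u → u ∉ rest → u ∉ x ∷ rest ⊎ u ≡ x
      coloured u u∉rest with u Fin.≟ x
      ... | yes u≡x = inj₂ u≡x
      ... | no u≢x  = inj₁ λ { (here u≡x) → u≢x u≡x ; (there u∈rest) → u∉rest u∈rest }

    proper-outside : ∀ {m R U} → R ⊆ U → All (OneNbrOutside U) R →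
      List2DistColorable (delete R) m → (∀ v → length (L v) ≡ m × Unique (L v)) →
      ∃[ c ] ProperOn (_∉ U) c
    proper-outside {R = R} {U} R⊆U one colourable lists with colourable L (λ v _ → lists v)
    ... | c , inL , distinct = c , (λ v → inL v ∘ kept-outside) , distinct′
      where
      kept-outside : ∀ {u} → u ∉ U → kept R u ≡ true
      kept-outside u∉U = kept-∉ (u∉U ∘ R⊆U)

      distinct′ : ∀ u v → u ∉ U → v ∉ U → u ≢ v → Near u v → c u ≢ c v
      distinct′ u v u∉U v∉U u≢v (inj₁ u~v) =
        distinct u v (kept-outside u∉U) (kept-outside v∉U) u≢v
          (inj₁ (true-∧ u~v (true-∧ (kept-outside u∉U) (kept-outside v∉U))))
      distinct′ u v u∉U v∉U u≢v (inj₂ (w , u~w , w~v)) with w ∈? R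
      ... | yes w∈R = ⊥-elim (u≢v (outside-nbrs-equal (All.lookup one w∈R) (Adj-sym u~w) w~v u∉U v∉U))
      ... | no w∉R  = distinct u v (kept-outside u∉U) (kept-outside v∉U) u≢v
        (inj₂ (w , true-∧ u~w (true-∧ (kept-outside u∉U) (kept-∉ w∉R))
                 , true-∧ w~v (true-∧ (kept-∉ w∉R) (kept-outside v∉U))))

  reducible-colourable : ∀ {m R U} → R ⊆ U → All (OneNbrOutside U) R → GreedyOrder m U →
    List2DistColorable (delete R) m → List2DistColorable (whole G) m
  reducible-colourable R⊆U one order colourable L lists
    with Colouring.proper-outside L R⊆U one colourable (λ v → lists v refl)
  ... | _ , proper with Colouring.greedy L (λ v → lists v refl) order proper
  ... | c , inL , distinct = c , (λ v _ → inL v tt) , (λ u v _ _ → distinct u v tt tt)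

module MinimalCounterexample
  (k : ℕ) (k≥17 : 17 ≤ k) (G : Graph) (Δ≤k : MaxDegLe G k)
  (uncolourable : ¬ List2DistColorable (whole G) (k + 2))
  (minimal : (H : Subgraph G) → Proper H → List2DistColorable H (k + 2)) where

  open GraphFacts G

  irreducible : ∀ {r R U} → r ∈ R → R ⊆ U → All (OneNbrOutside U) R → GreedyOrder (k + 2) U → ⊥
  irreducible {r} {R} r∈R R⊆U one order =
    uncolourable (reducible-colourable R⊆U one order (minimal (delete R) (inj₁ (r , kept-∈ r∈R))))

  2+<k+2 : ∀ {a d} → a < d → d ≤ k → 2 + a < k + 2
  2+<k+2 {a} a<d d≤k = subst (2 + a <_) (+-comm 2 k) (s≤s (s≤s (≤-trans a<d d≤k)))

  3+<k+2 : ∀ {a d} → a < d → d < k → 3 + a < k + 2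
  3+<k+2 {a} a<d d<k = subst (3 + a <_) (+-comm 2 k) (s≤s (s≤s (≤-trans (s≤s a<d) d<k)))

  ≤18⇒<k+2 : ∀ {a} → a ≤ 18 → a < k + 2
  ≤18⇒<k+2 a≤18 = ≤-trans (s≤s a≤18) (+-monoˡ-≤ 2 k≥17)

  S₁-reducible : ∀ {s y p z} →
    (∀ u → Adj G s u → u ≡ y ⊎ u ≡ p) → (∀ u → Adj G y u → u ≡ s ⊎ u ≡ z) →
    Adj G p s → Adj G z y → deg G p < k → ⊥
  S₁-reducible {s} {y} {p} {z} N[s] N[y] p~s z~y p<k =
    irreducible (here refl) id (y-out ∷ s-out ∷ []) (at-y ∷ at-s ∷ [])
    where
    y-out : OneNbrOutside (y ∷ s ∷ []) y
    y-out = z , λ u → map₁ (λ { refl → there (here refl) }) ∘ N[y] u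

    s-out : OneNbrOutside (y ∷ s ∷ []) s
    s-out = p , λ u → map₁ (λ { refl → here refl }) ∘ N[s] u

    at-y : Blockers (k + 2) (s ∷ []) y
    at-y = record
      { blockers = z ∷ p ∷ nbrs z ∖ y
      ; few      = 2+<k+2 (length-nbrs∖ z~y) (Δ≤k z)
      ; covers   = covers
      }
      where
      covers : ∀ u → u ∉ s ∷ [] → u ≢ y → Near y u → u ∈ z ∷ p ∷ nbrs z ∖ y
      covers u u∉ u≢y (inj₁ y~u) with N[y] u y~u
      ... | inj₁ refl = ⊥-elim (u∉ (here refl))
      ... | inj₂ refl = here refl
      covers u u∉ u≢y (inj₂ (w , y~w , w~u)) with N[y] w y~w
      ... | inj₂ refl = there (there (∈-nbrs∖ w~u u≢y))
      ... | inj₁ refl with N[s] u w~u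
      ...   | inj₁ refl = ⊥-elim (u≢y refl)
      ...   | inj₂ refl = there (here refl)

    at-s : Blockers (k + 2) [] s
    at-s = record
      { blockers = p ∷ y ∷ z ∷ nbrs p ∖ s
      ; few      = 3+<k+2 (length-nbrs∖ p~s) p<k
      ; covers   = covers
      }
      where
      covers : ∀ u → u ∉ [] → u ≢ s → Near s u → u ∈ p ∷ y ∷ z ∷ nbrs p ∖ s
      covers u _ u≢s (inj₁ s~u) with N[s] u s~u
      ... | inj₁ refl = there (here refl)
      ... | inj₂ refl = here refl
      covers u _ u≢s (inj₂ (w , s~w , w~u)) with N[s] w s~w
      ... | inj₂ refl = there (there (there (∈-nbrs∖ w~u u≢s)))
      ... | inj₁ refl with N[y] u w~u
      ...   | inj₁ refl = ⊥-elim (u≢s refl)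
      ...   | inj₂ refl = there (there (here refl))

  S₂-reducible : ∀ {s y p z w} →
    (∀ u → Adj G s u → u ≡ y ⊎ u ≡ p) → (∀ u → Adj G y u → u ≡ s ⊎ u ≡ z ⊎ u ≡ w) →
    Adj G p s → deg G s ≡ 2 → deg G z ≡ 2 → deg G w ≤ 7 → deg G p < k → ⊥
  S₂-reducible {s} {y} {p} {z} {w} N[s] N[y] p~s ds dz dw p<k =
    irreducible (here refl) (λ { (here refl) → here refl ; (there ()) }) (s-out ∷ []) (at-s ∷ at-y ∷ [])
    where
    s-out : OneNbrOutside (s ∷ y ∷ []) s
    s-out = p , λ u → map₁ (λ { refl → there (here refl) }) ∘ N[s] u

    at-s : Blockers (k + 2) (y ∷ []) s
    at-s = record
      { blockers = p ∷ z ∷ w ∷ nbrs p ∖ s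
      ; few      = 3+<k+2 (length-nbrs∖ p~s) p<k
      ; covers   = covers
      }
      where
      covers : ∀ u → u ∉ y ∷ [] → u ≢ s → Near s u → u ∈ p ∷ z ∷ w ∷ nbrs p ∖ s
      covers u u∉ u≢s (inj₁ s~u) with N[s] u s~u
      ... | inj₁ refl = ⊥-elim (u∉ (here refl))
      ... | inj₂ refl = here refl
      covers u u∉ u≢s (inj₂ (v , s~v , v~u)) with N[s] v s~v
      ... | inj₂ refl = there (there (there (∈-nbrs∖ v~u u≢s)))
      ... | inj₁ refl with N[y] u v~u
      ...   | inj₁ refl        = ⊥-elim (u≢s refl)
      ...   | inj₂ (inj₁ refl) = there (here refl)
      ...   | inj₂ (inj₂ refl) = there (there (here refl))

    second-nbhd : List Vertex
    second-nbhd = nbrs s ++ nbrs z ++ nbrs w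

    second-nbhd-small : 3 + length second-nbhd ≤ 18
    second-nbhd-small
      rewrite length-++ (nbrs s) {nbrs z ++ nbrs w} | length-++ (nbrs z) {nbrs w}
            | length-nbrs s | length-nbrs z | length-nbrs w | ds | dz = +-monoʳ-≤ 7 (≤-trans dw (m≤m+n 7 4))

    at-y : Blockers (k + 2) [] y
    at-y = record
      { blockers = s ∷ z ∷ w ∷ second-nbhd
      ; few      = ≤18⇒<k+2 second-nbhd-small
      ; covers   = covers
      }
      where
      covers : ∀ u → u ∉ [] → u ≢ y → Near y u → u ∈ s ∷ z ∷ w ∷ second-nbhd
      covers u _ _ (inj₁ y~u) with N[y] u y~u
      ... | inj₁ refl        = here refl
      ... | inj₂ (inj₁ refl) = there (here refl)
      ... | inj₂ (inj₂ refl) = there (there (here refl))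
      covers u _ _ (inj₂ (v , y~v , v~u)) with N[y] v y~v
      ... | inj₁ refl        = there (there (there (∈-++⁺ˡ (∈-nbrs⁺ v~u))))
      ... | inj₂ (inj₁ refl) = there (there (there (∈-++⁺ʳ (nbrs s) (∈-++⁺ˡ (∈-nbrs⁺ v~u)))))
      ... | inj₂ (inj₂ refl) = there (there (there (∈-++⁺ʳ (nbrs s) (∈-++⁺ʳ (nbrs z) (∈-nbrs⁺ v~u)))))

  pendant-blockers : ∀ {rest s a a′ p y} →
    (∀ u → Adj G s u → u ≡ a ⊎ u ≡ a′ ⊎ u ≡ p) → (∀ u → Adj G a u → u ≡ s ⊎ u ≡ y) →
    deg G y ≤ 14 → Blockers (k + 2) rest a
  pendant-blockers {s = s} {a} {a′} {p} {y} N[s] N[a] dy = record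
    { blockers = s ∷ y ∷ a′ ∷ p ∷ nbrs y
    ; few      = ≤18⇒<k+2 (s≤s (s≤s (s≤s (s≤s (subst (_≤ 14) (sym (length-nbrs y)) dy)))))
    ; covers   = covers
    }
    where
    covers : ∀ u → _ → u ≢ a → Near a u → u ∈ s ∷ y ∷ a′ ∷ p ∷ nbrs y
    covers u _ _ (inj₁ a~u) with N[a] u a~u
    ... | inj₁ refl = here refl
    ... | inj₂ refl = there (here refl)
    covers u _ u≢a (inj₂ (v , a~v , v~u)) with N[a] v a~v
    ... | inj₂ refl = there (there (there (there (∈-nbrs⁺ v~u))))
    ... | inj₁ refl with N[s] u v~u
    ...   | inj₁ refl        = ⊥-elim (u≢a refl)
    ...   | inj₂ (inj₁ refl) = there (there (here refl))
    ...   | inj₂ (inj₂ refl) = there (there (there (here refl)))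

  S₃-reducible : ∀ {s a₁ a₂ p y₁ y₂} →
    (∀ u → Adj G s u → u ≡ a₁ ⊎ u ≡ a₂ ⊎ u ≡ p) →
    (∀ u → Adj G a₁ u → u ≡ s ⊎ u ≡ y₁) → (∀ u → Adj G a₂ u → u ≡ s ⊎ u ≡ y₂) →
    Adj G p s → deg G y₁ ≤ 14 → deg G y₂ ≤ 14 → deg G p < k → ⊥
  S₃-reducible {s} {a₁} {a₂} {p} {y₁} {y₂} N[s] N[a₁] N[a₂] p~s dy₁ dy₂ p<k =
    irreducible (here refl) id (s-out ∷ a₁-out ∷ a₂-out ∷ [])
      (at-s ∷ pendant-blockers N[s] N[a₁] dy₁ ∷ pendant-blockers N[s]′ N[a₂] dy₂ ∷ [])
    where
    U : List Vertex
    U = s ∷ a₁ ∷ a₂ ∷ []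

    N[s]′ : ∀ u → Adj G s u → u ≡ a₂ ⊎ u ≡ a₁ ⊎ u ≡ p
    N[s]′ u s~u with N[s] u s~u
    ... | inj₁ u≡a₁        = inj₂ (inj₁ u≡a₁)
    ... | inj₂ (inj₁ u≡a₂) = inj₁ u≡a₂
    ... | inj₂ (inj₂ u≡p)  = inj₂ (inj₂ u≡p)

    s-out : OneNbrOutside U s
    s-out = p , λ u s~u → from-N[s] (N[s] u s~u)
      where
      from-N[s] : ∀ {u} → u ≡ a₁ ⊎ u ≡ a₂ ⊎ u ≡ p → u ∈ U ⊎ u ≡ p
      from-N[s] (inj₁ refl)        = inj₁ (there (here refl))
      from-N[s] (inj₂ (inj₁ refl)) = inj₁ (there (there (here refl)))
      from-N[s] (inj₂ (inj₂ u≡p))  = inj₂ u≡p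

    a₁-out : OneNbrOutside U a₁
    a₁-out = y₁ , λ u → map₁ (λ { refl → here refl }) ∘ N[a₁] u

    a₂-out : OneNbrOutside U a₂
    a₂-out = y₂ , λ u → map₁ (λ { refl → here refl }) ∘ N[a₂] u

    at-s : Blockers (k + 2) (a₁ ∷ a₂ ∷ []) s
    at-s = record
      { blockers = p ∷ y₁ ∷ y₂ ∷ nbrs p ∖ s
      ; few      = 3+<k+2 (length-nbrs∖ p~s) p<k
      ; covers   = covers
      }
      where
      covers : ∀ u → u ∉ a₁ ∷ a₂ ∷ [] → u ≢ s → Near s u → u ∈ p ∷ y₁ ∷ y₂ ∷ nbrs p ∖ s
      covers u u∉ u≢s (inj₁ s~u) with N[s] u s~u
      ... | inj₁ refl        = ⊥-elim (u∉ (here refl))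
      ... | inj₂ (inj₁ refl) = ⊥-elim (u∉ (there (here refl)))
      ... | inj₂ (inj₂ refl) = here refl
      covers u u∉ u≢s (inj₂ (v , s~v , v~u)) with N[s] v s~v
      covers u u∉ u≢s (inj₂ (v , s~v , v~u)) | inj₂ (inj₂ refl) = there (there (there (∈-nbrs∖ v~u u≢s)))
      covers u u∉ u≢s (inj₂ (v , s~v , v~u)) | inj₁ refl with N[a₁] u v~u
      ... | inj₁ refl = ⊥-elim (u≢s refl)
      ... | inj₂ refl = there (here refl)
      covers u u∉ u≢s (inj₂ (v , s~v , v~u)) | inj₂ (inj₁ refl) with N[a₂] u v~u
      ... | inj₁ refl = ⊥-elim (u≢s refl)
      ... | inj₂ refl = there (there (here refl))

  HeavyAnchor : Vertex → Set
  HeavyAnchor s = ∃[ p ] (Adj G s p × k ≤ deg G p × (∀ q → Adj G s q → 4 ≤ deg G q → q ≡ p))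

  only-heavy-nbr : ∀ {s p} → (∀ u → Adj G s u → u ≡ p ⊎ deg G u ≤ 3) →
    ∀ q → Adj G s q → 4 ≤ deg G q → q ≡ p
  only-heavy-nbr light q s~q 4≤q with light q s~q
  ... | inj₁ q≡p = q≡p
  ... | inj₂ q≤3 = ⊥-elim (<⇒≱ 4≤q q≤3)

  deg≡2⇒≤3 : ∀ {u} → deg G u ≡ 2 → deg G u ≤ 3
  deg≡2⇒≤3 d = ≤-trans (≤-reflexive d) (n≤1+n 2)

  support-anchor : ∀ s → Support G s → HeavyAnchor s
  support-anchor s (inj₁ (ds , y , s~y , dy))
    with other-nbr-of-deg2 ds s~y | other-nbr-of-deg2 dy (Adj-sym s~y)
  ... | p , _ , s~p , N[s] | z , _ , y~z , N[y] =
    p , s~p , ≮⇒≥ (S₁-reducible N[s] N[y] (Adj-sym s~p) (Adj-sym y~z)) , only-heavy-nbr light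
    where
    light : ∀ u → Adj G s u → u ≡ p ⊎ deg G u ≤ 3
    light u s~u with N[s] u s~u
    ... | inj₁ refl = inj₂ (deg≡2⇒≤3 dy)
    ... | inj₂ u≡p  = inj₁ u≡p
  support-anchor s (inj₂ (inj₁ (ds , y , z , w , s~y , dy , y~z , z≢s , dz , y~w , w≢s , w≢z , dw)))
    with other-nbr-of-deg2 ds s~y
  ... | p , _ , s~p , N[s] =
    p , s~p , ≮⇒≥ (S₂-reducible N[s] N[y] (Adj-sym s~p) ds dz dw) , only-heavy-nbr light
    where
    N[y] : ∀ u → Adj G y u → u ≡ s ⊎ u ≡ z ⊎ u ≡ w
    N[y] = nbrs-of-deg3 dy (Adj-sym s~y) y~z y~w z≢s w≢s w≢z

    light : ∀ u → Adj G s u → u ≡ p ⊎ deg G u ≤ 3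
    light u s~u with N[s] u s~u
    ... | inj₁ refl = inj₂ (≤-reflexive dy)
    ... | inj₂ u≡p  = inj₁ u≡p
  support-anchor s (inj₂ (inj₂ ((ds , a₁ , a₂ , y₁ , y₂ , a₁≢a₂ , s~a₁ , s~a₂ , da₁ , da₂ ,
                                 a₁~y₁ , y₁≢s , a₂~y₂ , y₂≢s , dy₁ , dy₂) , _)))
    with third-nbr-of-deg3 ds s~a₁ s~a₂ (≢-sym a₁≢a₂)
  ... | p , _ , _ , s~p , N[s] =
    p , s~p , ≮⇒≥ (S₃-reducible N[s] N[a₁] N[a₂] (Adj-sym s~p) dy₁ dy₂) , only-heavy-nbr light
    where
    N[a₁] : ∀ u → Adj G a₁ u → u ≡ s ⊎ u ≡ y₁
    N[a₁] = nbrs-of-deg2 da₁ (Adj-sym s~a₁) a₁~y₁ y₁≢s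

    N[a₂] : ∀ u → Adj G a₂ u → u ≡ s ⊎ u ≡ y₂
    N[a₂] = nbrs-of-deg2 da₂ (Adj-sym s~a₂) a₂~y₂ y₂≢s

    light : ∀ u → Adj G s u → u ≡ p ⊎ deg G u ≤ 3
    light u s~u with N[s] u s~u
    ... | inj₁ refl        = inj₂ (deg≡2⇒≤3 da₁)
    ... | inj₂ (inj₁ refl) = inj₂ (deg≡2⇒≤3 da₂)
    ... | inj₂ (inj₂ u≡p)  = inj₁ u≡p

  positive⇒deg≡k : ∀ v → Positive G v → deg G v ≡ k
  positive⇒deg≡k v (4≤v , s , v~s , support) with support-anchor s support
  ... | p , _ , k≤p , unique with unique v (Adj-sym v~s) 4≤v
  ... | refl = ≤-antisym (Δ≤k v) k≤p

  support⇒unique-positive-nbr : ∀ s → Support G s →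
    ∃[ p ] (Adj G s p × Positive G p × (∀ q → Adj G s q → Positive G q → q ≡ p))
  support⇒unique-positive-nbr s support with support-anchor s support
  ... | p , s~p , k≤p , unique =
    p , s~p , (≤-trans (m≤m+n 4 13) (≤-trans k≥17 k≤p) , s , Adj-sym s~p , support) ,
    λ q s~q → unique q s~q ∘ proj₁

lemma3 : (k : ℕ) → 17 ≤ k → (G : Graph) → MaxDegLe G k →
    ¬ List2DistColorable (whole G) (k + 2) →
    ((H : Subgraph G) → Proper H → List2DistColorable H (k + 2)) →
    ((v : Fin (n G)) → Positive G v → deg G v ≡ k) ×
    ((s : Fin (n G)) → Support G s →
       ∃[ p ] (Adj G s p × Positive G p ×
               ((q : Fin (n G)) → Adj G s q → Positive G q → q ≡ p)))
lemma3 k k≥17 G Δ≤k uncolourable minimal = positive⇒deg≡k , support⇒unique-positive-nbr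
  where open MinimalCounterexample k k≥17 G Δ≤k uncolourable minimal
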